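{- Consider the 36 consecutive patterns of relations $(\underline{R_1,R_2})$ with $R_1,R_2\in\{\leq,\geq,<,>,=,\neq\}$. The following generalized Wilf equivalences hold: (i) $(\underline{\geq,<})\stackrel{ss}{\sim}(\underline{<,\geq})\sim(\underline{\neq,\geq})$; (ii) $(\underline{\geq,\geq})\stackrel{ss}{\sim}(\underline{<,<})$; (iii) $(\underline{\geq,=})\stackrel{ss}{\sim}(\underline{=,\geq})$; (iv) $(\underline{\geq,>})\stackrel{ss}{\sim}(\underline{>,\geq})$; (v) $(\underline{>,=})\stackrel{ss}{\sim}(\underline{=,>})$. Moreover, this list is complete: any two distinct patterns among the 36 that do not appear together in one of the groups (i)–(v) are not Wilf equivalent.
   Context: An inversion sequence of length $n$ is an integer sequence $e=e_1e_2\dots e_n$ with $0\le e_i<i$ for all $i$; $\mathbf{I}_n$ denotes the set of these. For binary relations $R_1,R_2\in\{\leq,\geq,<,>,=,\neq\}$, an inversion sequence $e$ contains the consecutive pattern of relations $(\underline{R_1,R_2})$ if there is an index $i$ with $e_iR_1e_{i+1}$ and $e_{i+1}R_2e_{i+2}$; then $e_ie_{i+1}e_{i+2}$ is an occurrence in position $i$. Otherwise $e$ avoids the pattern; $\mathbf{I}_n(\underline{R_1,R_2})$ is the set of $e\in\mathbf{I}_n$ avoiding it. Two patterns $p,p'$ are Wilf equivalent ($p\sim p'$) if $|\mathbf{I}_n(p)|=|\mathbf{I}_n(p')|$ for all $n$; strongly Wilf equivalent if for all $n,m$ the number of $e\in\mathbf{I}_n$ with exactly $m$ occurrences of $p$ equals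 that for $p'$; super-strongly Wilf equivalent ($p\stackrel{ss}{\sim}p'$) if for all $n$ and all $S\subseteq[n]$ the number of $e\in\mathbf{I}_n$ whose set of positions of occurrences of $p$ is exactly $S$ equals the corresponding number for $p'$. -}

module Defs where

open import Data.Nat using (ℕ; zero; suc; _≤ᵇ_; _<ᵇ_; _≡ᵇ_)
open import Data.Bool using (Bool; true; false; _∧_; not)
open import Data.List using (List; []; _∷_; [_]; concatMap; map; upTo; filter; length)
open import Data.Vec using (Vec; _∷ʳ_; toList; tabulate)
open import Data.Vec.Properties using (≡-dec)
open import Data.Bool.Properties using () renaming (_≟_ to _≟B_)
open import Data.Fin using (Fin; toℕ)
open import Data.Fin.Subset using (Subset; ⊥)
open import Data.Product using (_×_; _,_; Σ)
open import Relation.Binary.PropositionalEquality using (_≡_)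

data Rel : Set where
  LE GE LT GT EQ NE : Rel

⟦_⟧ : Rel → ℕ → ℕ → Bool
⟦ LE ⟧ a b = a ≤ᵇ b
⟦ GE ⟧ a b = b ≤ᵇ a
⟦ LT ⟧ a b = a <ᵇ b
⟦ GT ⟧ a b = b <ᵇ a
⟦ EQ ⟧ a b = a ≡ᵇ b
⟦ NE ⟧ a b = not (a ≡ᵇ b)

Pattern : Set
Pattern = Rel × Rel

-- All inversion sequences of length n (e_1 … e_n with 0 ≤ e_i < i),
-- built by appending the last entry e_{n+1} ∈ {0,…,n}.
allInv : (n : ℕ) → List (Vec ℕ n)
allInv zero = [ Data.Vec.[] ]
allInv (suc n) = concatMap (λ e → map (λ k → e ∷ʳ k) (upTo (suc n))) (allInv n)

-- occAt p w j : is there an occurrence of p in position j+1 of the word w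
-- (i.e. w_{j+1} R1 w_{j+2} and w_{j+2} R2 w_{j+3}, 1-indexed)?
occAt : Pattern → List ℕ → ℕ → Bool
occAt (R₁ , R₂) (a ∷ b ∷ c ∷ r) zero = ⟦ R₁ ⟧ a b ∧ ⟦ R₂ ⟧ b c
occAt p (_ ∷ r) (suc j) = occAt p r j
occAt _ _ _ = false

-- Set of positions of occurrences of p in e, as a subset of [n]
-- (index i : Fin n stands for position toℕ i + 1).
occSet : Pattern → {n : ℕ} → Vec ℕ n → Subset n
occSet p e = tabulate (λ i → occAt p (toList e) (toℕ i))

numExact : Pattern → (n : ℕ) → Subset n → ℕ
numExact p n S = length (filter (λ e → ≡-dec _≟B_ (occSet p e) S) (allInv n))

numAvoid : Pattern → ℕ → ℕ
numAvoid p n = numExact p n ⊥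

Wilf : Pattern → Pattern → Set
Wilf p q = (n : ℕ) → numAvoid p n ≡ numAvoid q n

SuperStrong : Pattern → Pattern → Set
SuperStrong p q = (n : ℕ) (S : Subset n) → numExact p n S ≡ numExact q n S

data InGroup : Fin 5 → Pattern → Set where
  g1a : InGroup Fin.zero (GE , LT)
  g1b : InGroup Fin.zero (LT , GE)
  g1c : InGroup Fin.zero (NE , GE)
  g2a : InGroup (Fin.suc Fin.zero) (GE , GE)
  g2b : InGroup (Fin.suc Fin.zero) (LT , LT)
  g3a : InGroup (Fin.suc (Fin.suc Fin.zero)) (GE , EQ)
  g3b : InGroup (Fin.suc (Fin.suc Fin.zero)) (EQ , GE)
  g4a : InGroup (Fin.suc (Fin.suc (Fin.suc Fin.zero))) (GE , GT)
  g4b : InGroup (Fin.suc (Fin.suc (Fin.suc Fin.zero))) (GT , GE)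
  g5a : InGroup (Fin.suc (Fin.suc (Fin.suc (Fin.suc Fin.zero)))) (GT , EQ)
  g5b : InGroup (Fin.suc (Fin.suc (Fin.suc (Fin.suc Fin.zero)))) (EQ , GT)

SameGroup : Pattern → Pattern → Set
SameGroup p q = Σ (Fin 5) (λ g → InGroup g p × InGroup g q)

module Submission where

-- Positions are 0-based: an inversion sequence is e₀ … e_m with
-- 0 ≤ e_t ≤ t, and an occurrence at i involves e_i e_{i+1} e_{i+2}.
--
-- By inclusion–exclusion over the positions
-- (inclusion-exclusion) it suffices to compare, for every set τ of
-- demanded positions, the numbers of inversion sequences with an
-- occurrence at every position of τ.  A demanded occurrence at i puts R₁
-- on the pair (e_i, e_{i+1}) and R₂ on (e_{i+1}, e_{i+2}), so these
-- numbers are values of a transfer matrix acting on weights of the last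
-- entry (paths, count≡paths).  Two criteria compare transfer matrices:
-- complementing entries, e_t ↦ t ∸ e_t, exchanges ≥ and <
-- (complement-criterion: groups (i), (ii)); and along a run of demanded
-- positions the operators of p and q are A D … D B and C D … D B′ with D
-- commuting with A and C and A B = C B′ (RunCriterion: groups (iii)–(v)).
--
-- Wilf equivalence (<,≥) ∼ (≠,≥): an inversion sequence starts with 0, so
-- it avoids either pattern exactly when it is 0 … 0 followed by a strictly
-- increasing run.
--
-- Completeness of the list: the 36 numbers |I₆(p)| coincide only within
-- the groups, which is checked by computation.

open import Defs
open import Data.Bool using (Bool; true; false; _∧_; not; if_then_else_)
open import Data.Bool.ListAction using (and)
open import Data.Bool.Properties using (∧-comm; ∧-assoc; ∧-identityʳ; ∧-zeroʳ) renaming (_≟_ to _≟ᵇ_)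
open import Data.Fin using (Fin; toℕ)
import Data.Fin as Fin
open import Data.Fin.Subset using (Subset)
import Data.Fin.Subset as Subset
open import Data.List using (List; []; _∷_; _++_; [_]; length; map; concatMap; applyUpTo; filter)
open import Data.List.Properties using (map-++; map-cong; map-cong-local; map-applyUpTo)
open import Data.List.Relation.Unary.All using (All; []; _∷_)
import Data.List.Relation.Unary.All as All
open import Data.List.Relation.Unary.All.Properties using (concat⁺; map⁺; applyUpTo⁺₁; applyUpTo⁺₂)
open import Data.Nat using (ℕ; zero; suc; _+_; _∸_; _≤_; _<_; z≤n; s≤s; _≤ᵇ_; _<ᵇ_; _≡ᵇ_; _≤?_)
open import Data.Nat.ListAction using (sum)
open import Data.Nat.ListAction.Properties using (sum-++)
open import Data.Nat.Properties
open import Algebra.Properties.CommutativeSemigroup +-commutativeSemigroup using (interchange)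
open import Data.Product using (Σ; _×_; _,_)
open import Data.Sum using (_⊎_; inj₁; inj₂)
open import Data.Unit using (⊤; tt)
open import Data.Vec using (Vec; []; _∷_; toList; tabulate; lookup; _∷ʳ_; _[_]≔_)
import Data.Vec as Vec
open import Data.Vec.Properties using (≡-dec; toList-∷ʳ; length-toList; []≔-lookup)
open import Data.Empty using (⊥-elim)
open import Function using (_∘_; id)
open import Level using (0ℓ)
open import Relation.Binary.Definitions using (tri<; tri≈; tri>)
open import Relation.Binary.PropositionalEquality hiding ([_])
open import Relation.Nullary using (¬_; does; yes; no; contradiction)
open import Relation.Nullary.Reflects using (Reflects; ofʸ; ofⁿ; fromEquivalence)
open import Relation.Unary using (Pred; Decidable)

_⇒ᵇ_ : Bool → Bool → Bool
true  ⇒ᵇ b = b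
false ⇒ᵇ _ = true

when : Bool → ℕ → ℕ
when b x = if b then x else 0

𝟙 : Bool → ℕ
𝟙 b = when b 1

reflects-true : ∀ {A : Set} {b} → Reflects A b → A → b ≡ true
reflects-true (ofʸ _) _ = refl
reflects-true (ofⁿ ¬a) a = ⊥-elim (¬a a)

reflects-false : ∀ {A : Set} {b} → Reflects A b → ¬ A → b ≡ false
reflects-false (ofʸ a) ¬a = ⊥-elim (¬a a)
reflects-false (ofⁿ _) _ = refl

≡ᵇ-reflects-≡ : ∀ m n → Reflects (m ≡ n) (m ≡ᵇ n)
≡ᵇ-reflects-≡ m n = fromEquivalence (≡ᵇ⇒≡ m n) (≡⇒≡ᵇ m n)

reflects-iff : ∀ {A B : Set} {b c} → Reflects A b → Reflects B c → (A → B) → (B → A) → b ≡ c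
reflects-iff (ofʸ a) (ofʸ _) _ _ = refl
reflects-iff (ofʸ a) (ofⁿ ¬b) f _ = contradiction (f a) ¬b
reflects-iff (ofⁿ ¬a) (ofʸ b) _ g = contradiction (g b) ¬a
reflects-iff (ofⁿ _) (ofⁿ _) _ _ = refl

∑< : ℕ → (ℕ → ℕ) → ℕ
∑< n f = sum (applyUpTo f n)

syntax ∑< n (λ k → e) = ∑[ k < n ] e

⋀< : ℕ → (ℕ → Bool) → Bool
⋀< n f = and (applyUpTo f n)

syntax ⋀< n (λ k → e) = ⋀[ k < n ] e

∑-cong : ∀ n {f g : ℕ → ℕ} → (∀ k → k < n → f k ≡ g k) → ∑< n f ≡ ∑< n g
∑-cong zero    _ = refl
∑-cong (suc n) h = cong₂ _+_ (h 0 (s≤s z≤n)) (∑-cong n (λ k k<n → h (suc k) (s≤s k<n)))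

∑-zero : ∀ n → ∑[ k < n ] 0 ≡ 0
∑-zero zero    = refl
∑-zero (suc n) = ∑-zero n

∑-snoc : ∀ n f → ∑< (suc n) f ≡ ∑< n f + f n
∑-snoc zero    f = +-comm (f 0) 0
∑-snoc (suc n) f = trans (cong (f 0 +_) (∑-snoc n (λ k → f (suc k)))) (sym (+-assoc (f 0) _ _))

∑-reverse : ∀ n f → ∑< (suc n) f ≡ ∑[ k < suc n ] f (n ∸ k)
∑-reverse zero    f = refl
∑-reverse (suc n) f = begin
  f 0 + ∑[ k < suc n ] f (suc k)          ≡⟨ cong (f 0 +_) (∑-reverse n (λ k → f (suc k))) ⟩
  f 0 + ∑[ k < suc n ] f (suc (n ∸ k))    ≡⟨ cong (f 0 +_) (∑-cong (suc n) λ k k≤n →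
                                               cong f (sym (+-∸-assoc 1 (≤-pred k≤n)))) ⟩
  f 0 + ∑[ k < suc n ] f (suc n ∸ k)      ≡⟨ +-comm (f 0) _ ⟩
  ∑[ k < suc n ] f (suc n ∸ k) + f 0      ≡⟨ cong (λ i → ∑[ k < suc n ] f (suc n ∸ k) + f i) (sym (n∸n≡0 (suc n))) ⟩
  ∑[ k < suc n ] f (suc n ∸ k) + f (suc n ∸ suc n)
                                          ≡⟨ sym (∑-snoc (suc n) (λ k → f (suc n ∸ k))) ⟩
  ∑[ k < suc (suc n) ] f (suc n ∸ k)      ∎
  where open ≡-Reasoning

∑-below : ∀ N v g → v ≤ N → ∑[ k < N ] when (k <ᵇ v) (g k) ≡ ∑< v g
∑-below N       zero    g _         = ∑-zero N
∑-below (suc N) (suc v) g (s≤s v≤N) = cong (g 0 +_) (∑-below N v (λ k → g (suc k)) v≤N)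

∑-upTo : ∀ N v g → v < N → ∑[ k < N ] when (k ≤ᵇ v) (g k) ≡ ∑< (suc v) g
∑-upTo N v g v<N =
  trans (∑-cong N (λ k _ → cong (λ c → when c (g k)) (sym (lt-suc k v)))) (∑-below N (suc v) g v<N)
  where
    lt-suc : ∀ k v → (k <ᵇ suc v) ≡ (k ≤ᵇ v)
    lt-suc zero    v = refl
    lt-suc (suc k) v = refl

∑-at : ∀ N v g → v < N → ∑[ k < N ] when (v ≡ᵇ k) (g k) ≡ g v
∑-at (suc N) zero    g _         = trans (cong (g 0 +_) (∑-zero N)) (+-identityʳ (g 0))
∑-at (suc N) (suc v) g (s≤s v<N) = ∑-at N v (λ k → g (suc k)) v<N

∑-guard : ∀ N b (c : ℕ → Bool) (g : ℕ → ℕ) → ∑[ k < N ] when (b ∧ c k) (g k) ≡ when b (∑[ k < N ] when (c k) (g k))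
∑-guard N true  c g = refl
∑-guard N false c g = ∑-zero N

⋀-cong : ∀ n {f g : ℕ → Bool} → (∀ i → i < n → f i ≡ g i) → ⋀< n f ≡ ⋀< n g
⋀-cong zero    _ = refl
⋀-cong (suc n) h = cong₂ _∧_ (h 0 (s≤s z≤n)) (⋀-cong n (λ i i<n → h (suc i) (s≤s i<n)))

⋀-snoc : ∀ n f → ⋀< (suc n) f ≡ ⋀< n f ∧ f n
⋀-snoc zero    f = ∧-identityʳ (f 0)
⋀-snoc (suc n) f = trans (cong (f 0 ∧_) (⋀-snoc n (λ i → f (suc i)))) (sym (∧-assoc (f 0) _ _))

-- The transfer matrix.  A set of demanded positions is a predicate
-- τ : ℕ → Bool; an entry v at position m is followed by some k ≤ m + 1.

previous : (ℕ → Bool) → ℕ → Bool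
previous τ zero    = false
previous τ (suc t) = τ t

-- A pair (a, b) of consecutive entries must satisfy R₁ when an occurrence
-- starting at it is demanded ("opens") and R₂ when one starting one step
-- earlier is demanded ("closes").
allowed : Pattern → Bool → Bool → ℕ → ℕ → Bool
allowed (R₁ , R₂) opens closes a b = (opens ⇒ᵇ ⟦ R₁ ⟧ a b) ∧ (closes ⇒ᵇ ⟦ R₂ ⟧ a b)

-- One transfer step: g is a weight on the entry in position m + 1, which
-- ranges over [0, m + 1]; the result is a weight on the entry v before it.
extendWith : Pattern → Bool → Bool → ℕ → (ℕ → ℕ) → ℕ → ℕ
extendWith p opens closes m g v = ∑[ k < 2 + m ] when (allowed p opens closes v k) (g k)

extend : Pattern → (ℕ → Bool) → ℕ → (ℕ → ℕ) → ℕ → ℕ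
extend p τ m = extendWith p (τ m) (previous τ m) m

-- Total weight of the admissible paths e₀ e₁ … e_m (0 ≤ e_t ≤ t) with a
-- final weight g(e_m): the transfer-matrix value.
paths : Pattern → (ℕ → Bool) → ℕ → (ℕ → ℕ) → ℕ
paths p τ zero    g = g 0
paths p τ (suc m) g = paths p τ m (extend p τ m g)

_≈[_]_ : (ℕ → ℕ) → ℕ → (ℕ → ℕ) → Set
f ≈[ N ] g = ∀ v → v < N → f v ≡ g v

extendWith-cong : ∀ p o c m {f g} → f ≈[ 2 + m ] g → ∀ v → extendWith p o c m f v ≡ extendWith p o c m g v
extendWith-cong p o c m f≈g v = ∑-cong (2 + m) (λ k k< → cong (when (allowed p o c v k)) (f≈g k k<))

paths-cong : ∀ p τ m {f g} → f ≈[ suc m ] g → paths p τ m f ≡ paths p τ m g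
paths-cong p τ zero    f≈g = f≈g 0 (s≤s z≤n)
paths-cong p τ (suc m) f≈g = paths-cong p τ m (λ v _ → extendWith-cong p (τ m) (previous τ m) m f≈g v)

extend-at : ∀ p τ m g v {o c} → τ m ≡ o → previous τ m ≡ c → extend p τ m g v ≡ extendWith p o c m g v
extend-at p τ m g v e₁ e₂ = cong₂ (λ o c → extendWith p o c m g v) e₁ e₂

nth : List ℕ → ℕ → ℕ
nth []       _       = 0
nth (x ∷ xs) zero    = x
nth (x ∷ xs) (suc i) = nth xs i

nth-++ : ∀ w ys i → i < length w → nth (w ++ ys) i ≡ nth w i
nth-++ (x ∷ w) ys zero    _         = refl
nth-++ (x ∷ w) ys (suc i) (s≤s i<n) = nth-++ w ys i i<n

nth-last : ∀ w k → nth (w ++ [ k ]) (length w) ≡ k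
nth-last []      k = refl
nth-last (x ∷ w) k = nth-last w k

respects : Pattern → (ℕ → Bool) → List ℕ → ℕ → Bool
respects p τ w m = ⋀[ t < m ] allowed p (τ t) (previous τ t) (nth w t) (nth w (suc t))

respects-snoc : ∀ p τ w k m → length w ≡ suc m →
  respects p τ (w ++ [ k ]) (suc m) ≡ respects p τ w m ∧ allowed p (τ m) (previous τ m) (nth w m) k
respects-snoc p τ w k m len = trans (⋀-snoc m _) (cong₂ _∧_
  (⋀-cong m λ t t<m → cong₂ (allowed p (τ t) (previous τ t))
     (nth-++ w [ k ] t (subst (t <_) (sym len) (m≤n⇒m≤1+n t<m)))
     (nth-++ w [ k ] (suc t) (subst (suc t <_) (sym len) (s≤s t<m))))
  (cong₂ (allowed p (τ m) (previous τ m))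
     (nth-++ w [ k ] m (subst (m <_) (sym len) ≤-refl))
     (trans (cong (nth (w ++ [ k ])) (sym len)) (nth-last w k))))

sumOver : {A : Set} → List A → (A → ℕ) → ℕ
sumOver xs h = sum (map h xs)

sumOver-cong : {A : Set} (xs : List A) {h h′ : A → ℕ} → (∀ x → h x ≡ h′ x) → sumOver xs h ≡ sumOver xs h′
sumOver-cong xs h≗h′ = cong sum (map-cong h≗h′ xs)

sumOver-concatMap : {A B : Set} (xs : List A) (f : A → List B) (h : B → ℕ) →
  sumOver (concatMap f xs) h ≡ sumOver xs (λ x → sumOver (f x) h)
sumOver-concatMap []       f h = refl
sumOver-concatMap (x ∷ xs) f h = begin
  sum (map h (f x ++ concatMap f xs))               ≡⟨ cong sum (map-++ h (f x) (concatMap f xs)) ⟩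
  sum (map h (f x) ++ map h (concatMap f xs))       ≡⟨ sum-++ (map h (f x)) _ ⟩
  sumOver (f x) h + sumOver (concatMap f xs) h      ≡⟨ cong (sumOver (f x) h +_) (sumOver-concatMap xs f h) ⟩
  sumOver (f x) h + sumOver xs (λ y → sumOver (f y) h) ∎
  where open ≡-Reasoning

sumOver-applyUpTo : {A : Set} (f : ℕ → A) (n : ℕ) (h : A → ℕ) → sumOver (applyUpTo f n) h ≡ ∑< n (h ∘ f)
sumOver-applyUpTo f n h = cong sum (map-applyUpTo f h n)

sumOver-when : {A : Set} (xs : List A) (b : Bool) (h : A → ℕ) →
  sumOver xs (λ x → when b (h x)) ≡ when b (sumOver xs h)
sumOver-when xs       true  h = refl
sumOver-when []       false h = refl
sumOver-when (x ∷ xs) false h = sumOver-when xs false h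

weighted : Pattern → (ℕ → Bool) → ℕ → (ℕ → ℕ) → ℕ
weighted p τ m g = sumOver (allInv (suc m)) λ e → when (respects p τ (toList e) m) (g (nth (toList e) m))

-- Appending the entry k to e: the new pair is the only new constraint.
weighted-append : ∀ p τ m g (e : Vec ℕ (suc m)) →
  ∑[ k < 2 + m ] when (respects p τ (toList (e ∷ʳ k)) (suc m)) (g (nth (toList (e ∷ʳ k)) (suc m)))
  ≡ when (respects p τ (toList e) m) (extend p τ m g (nth (toList e) m))
weighted-append p τ m g e = trans
  (∑-cong (2 + m) λ k _ → trans
    (cong (λ w → when (respects p τ w (suc m)) (g (nth w (suc m)))) (toList-∷ʳ k e))
    (cong₂ (λ b x → when b (g x))
      (respects-snoc p τ (toList e) k m (length-toList e))
      (trans (cong (nth (toList e ++ [ k ])) (sym (length-toList e))) (nth-last (toList e) k))))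
  (∑-guard (2 + m) (respects p τ (toList e) m) (allowed p (τ m) (previous τ m) (nth (toList e) m)) g)

weighted-step : ∀ p τ m g → weighted p τ (suc m) g ≡ weighted p τ m (extend p τ m g)
weighted-step p τ m g = begin
  weighted p τ (suc m) g
    ≡⟨ sumOver-concatMap (allInv (suc m)) (λ e → map (e ∷ʳ_) (applyUpTo id (2 + m))) h ⟩
  sumOver (allInv (suc m)) (λ e → sumOver (map (e ∷ʳ_) (applyUpTo id (2 + m))) h)
    ≡⟨ sumOver-cong (allInv (suc m)) (λ e →
         trans (cong (λ xs → sumOver xs h) (map-applyUpTo id (e ∷ʳ_) (2 + m)))
               (trans (sumOver-applyUpTo (e ∷ʳ_) (2 + m) h) (weighted-append p τ m g e))) ⟩
  weighted p τ m (extend p τ m g) ∎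
  where
    open ≡-Reasoning
    h : Vec ℕ (2 + m) → ℕ
    h e = when (respects p τ (toList e) (suc m)) (g (nth (toList e) (suc m)))

weighted≡paths : ∀ p τ m g → weighted p τ m g ≡ paths p τ m g
weighted≡paths p τ zero    g = +-identityʳ (g 0)
weighted≡paths p τ (suc m) g = trans (weighted-step p τ m g) (weighted≡paths p τ m (extend p τ m g))

occAt-suc : ∀ p a r j → occAt p (a ∷ r) (suc j) ≡ occAt p r j
occAt-suc p a []           j = refl
occAt-suc p a (b ∷ [])     j = refl
occAt-suc p a (b ∷ c ∷ r)  j = refl

occAt-nth : ∀ R₁ R₂ w i → occAt (R₁ , R₂) w i ≡
  (2 + i <ᵇ length w) ∧ (⟦ R₁ ⟧ (nth w i) (nth w (suc i)) ∧ ⟦ R₂ ⟧ (nth w (suc i)) (nth w (2 + i)))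
occAt-nth R₁ R₂ []              zero    = refl
occAt-nth R₁ R₂ []              (suc i) = refl
occAt-nth R₁ R₂ (a ∷ [])        zero    = refl
occAt-nth R₁ R₂ (a ∷ b ∷ [])    zero    = refl
occAt-nth R₁ R₂ (a ∷ b ∷ c ∷ r) zero    = refl
occAt-nth R₁ R₂ (a ∷ r)         (suc j) = trans (occAt-suc (R₁ , R₂) a r j) (occAt-nth R₁ R₂ r j)

demandsMet : Pattern → (ℕ → Bool) → List ℕ → ℕ → Bool
demandsMet p τ w n = ⋀[ i < n ] (τ i ⇒ᵇ occAt p w i)

-- No occurrence is demanded at the last two positions of a word of length
-- m + 1, where none can start.
tailFree : (ℕ → Bool) → ℕ → Bool
tailFree τ zero    = not (τ 0)
tailFree τ (suc m) = not (τ m) ∧ not (τ (suc m))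

tailFree⇒¬previous : ∀ τ m → tailFree τ m ≡ true → previous τ m ≡ false
tailFree⇒¬previous τ zero    _ = refl
tailFree⇒¬previous τ (suc m) e with τ m
... | false = refl
... | true  = sym e

-- Boolean regroupings: an occurrence at i is the conjunction of the first
-- relation on pair i and the second relation on pair i + 1.
regroup : ∀ X a x y c → (X ∧ (a ⇒ᵇ x)) ∧ (c ∧ (a ⇒ᵇ y)) ≡ (X ∧ (a ⇒ᵇ (x ∧ y))) ∧ c
regroup false a     x     y c = refl
regroup true  false x     y c = ∧-identityʳ c
regroup true  true  false y c = refl
regroup true  true  true  y c = ∧-comm c y

close-tail : ∀ X a x b → (X ∧ not a) ∧ not b ≡ (X ∧ (a ⇒ᵇ x)) ∧ (not a ∧ not b)
close-tail false a     x b = refl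
close-tail true  false x b = refl
close-tail true  true  x b = sym (∧-zeroʳ x)

⇒ᵇ-false : ∀ a → (a ⇒ᵇ false) ≡ not a
⇒ᵇ-false true  = refl
⇒ᵇ-false false = refl

module _ (R₁ R₂ : Rel) (τ : ℕ → Bool) (w : List ℕ) where

  private
    first second : ℕ → Bool
    first  i = ⟦ R₁ ⟧ (nth w i) (nth w (suc i))
    second i = ⟦ R₂ ⟧ (nth w (suc i)) (nth w (2 + i))

    pair : ℕ → Bool
    pair t = allowed (R₁ , R₂) (τ t) (previous τ t) (nth w t) (nth w (suc t))

    realised : ℕ → Bool
    realised i = τ i ⇒ᵇ (first i ∧ second i)

  respects-regrouped : ∀ m → respects (R₁ , R₂) τ w (suc m) ≡ ⋀< m realised ∧ (τ m ⇒ᵇ first m)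
  respects-regrouped zero    = trans (∧-identityʳ (pair 0)) (∧-identityʳ (τ 0 ⇒ᵇ first 0))
  respects-regrouped (suc m) = begin
    ⋀< (2 + m) pair                                              ≡⟨ ⋀-snoc (suc m) pair ⟩
    ⋀< (suc m) pair ∧ pair (suc m)                               ≡⟨ cong (_∧ pair (suc m)) (respects-regrouped m) ⟩
    (⋀< m realised ∧ (τ m ⇒ᵇ first m)) ∧ pair (suc m)           ≡⟨ regroup (⋀< m realised) (τ m) (first m) (second m) _ ⟩
    (⋀< m realised ∧ realised m) ∧ (τ (suc m) ⇒ᵇ first (suc m)) ≡⟨ cong (_∧ (τ (suc m) ⇒ᵇ first (suc m)))
                                                                      (sym (⋀-snoc m realised)) ⟩
    ⋀< (suc m) realised ∧ (τ (suc m) ⇒ᵇ first (suc m))          ∎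
    where open ≡-Reasoning

  demandsMet≡respects : ∀ m → length w ≡ suc m →
    demandsMet (R₁ , R₂) τ w (suc m) ≡ respects (R₁ , R₂) τ w m ∧ tailFree τ m
  demandsMet≡respects zero len = trans (∧-identityʳ (τ 0 ⇒ᵇ occAt (R₁ , R₂) w 0))
    (trans (cong (τ 0 ⇒ᵇ_) (trans (occAt-nth R₁ R₂ w 0) (cong (λ n → (2 <ᵇ n) ∧ (first 0 ∧ second 0)) len)))
           (⇒ᵇ-false (τ 0)))
  demandsMet≡respects (suc m) len = begin
    ⋀< (2 + m) checked                                     ≡⟨ ⋀-snoc (suc m) checked ⟩
    ⋀< (suc m) checked ∧ checked (suc m)                  ≡⟨ cong (_∧ checked (suc m)) (⋀-snoc m checked) ⟩
    (⋀< m checked ∧ checked m) ∧ checked (suc m)         ≡⟨ cong₂ _∧_ (cong₂ _∧_ inner (noOccurrence m ≤-refl))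
                                                                          (noOccurrence (suc m) (n≤1+n m)) ⟩
    (⋀< m realised ∧ not (τ m)) ∧ not (τ (suc m))           ≡⟨ close-tail (⋀< m realised) (τ m) (first m) (τ (suc m)) ⟩
    (⋀< m realised ∧ (τ m ⇒ᵇ first m)) ∧ tailFree τ (suc m) ≡⟨ cong (_∧ tailFree τ (suc m)) (sym (respects-regrouped m)) ⟩
    respects (R₁ , R₂) τ w (suc m) ∧ tailFree τ (suc m)     ∎
    where
      open ≡-Reasoning
      checked : ℕ → Bool
      checked i = τ i ⇒ᵇ occAt (R₁ , R₂) w i
      at : ∀ i → occAt (R₁ , R₂) w i ≡ (2 + i <ᵇ 2 + m) ∧ (first i ∧ second i)
      at i = trans (occAt-nth R₁ R₂ w i) (cong (λ n → (2 + i <ᵇ n) ∧ (first i ∧ second i)) len)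
      inner : ⋀< m checked ≡ ⋀< m realised
      inner = ⋀-cong m λ i i<m → cong (τ i ⇒ᵇ_) (trans (at i)
        (cong (_∧ (first i ∧ second i)) (reflects-true (<ᵇ-reflects-< (2 + i) (2 + m)) (s≤s (s≤s i<m)))))
      noOccurrence : ∀ i → m ≤ i → checked i ≡ not (τ i)
      noOccurrence i m≤i = trans (cong (τ i ⇒ᵇ_) (trans (at i)
        (cong (_∧ (first i ∧ second i)) (reflects-false (<ᵇ-reflects-< (2 + i) (2 + m)) (λ lt → <⇒≱ lt (s≤s (s≤s m≤i)))))))
        (⇒ᵇ-false (τ i))

data Demand : Set where
  free present absent : Demand

meets : Demand → Bool → Bool
meets free    _ = true
meets present b = b
meets absent  b = not b

satisfies : ∀ {n} → Vec Demand n → Subset n → Bool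
satisfies []      []      = true
satisfies (d ∷ σ) (b ∷ u) = meets d b ∧ satisfies σ u

count : Pattern → (n : ℕ) → Vec Demand n → ℕ
count p n σ = sumOver (allInv n) λ e → 𝟙 (satisfies σ (occSet p e))

exactly : ∀ {n} → Subset n → Vec Demand n
exactly = Vec.map (λ b → if b then present else absent)

length-filter : {A : Set} {P : Pred A 0ℓ} (P? : Decidable P) (xs : List A) →
  length (filter P? xs) ≡ sumOver xs (λ x → 𝟙 (does (P? x)))
length-filter P? []       = refl
length-filter P? (x ∷ xs) with does (P? x)
... | true  = cong suc (length-filter P? xs)
... | false = length-filter P? xs

decide-exactly : ∀ {n} (u S : Subset n) → does (≡-dec _≟ᵇ_ u S) ≡ satisfies (exactly S) u
decide-exactly []      []      = refl
decide-exactly (x ∷ u) (y ∷ S) = cong₂ _∧_ (bit x y) (decide-exactly u S)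
  where
    bit : ∀ x y → does (x ≟ᵇ y) ≡ meets (if y then present else absent) x
    bit true  true  = refl
    bit true  false = refl
    bit false true  = refl
    bit false false = refl

numExact≡count : ∀ p n S → numExact p n S ≡ count p n (exactly S)
numExact≡count p n S = trans (length-filter (λ e → ≡-dec _≟ᵇ_ (occSet p e) S) (allInv n))
  (sumOver-cong (allInv n) λ e → cong 𝟙 (decide-exactly (occSet p e) S))

satisfies-at : ∀ {n} (σ : Vec Demand n) j u d →
  satisfies (σ [ j ]≔ d) u ≡ satisfies (σ [ j ]≔ free) u ∧ meets d (lookup u j)
satisfies-at (_ ∷ σ) Fin.zero    (x ∷ u) d = ∧-comm (meets d x) (satisfies σ u)
satisfies-at (e ∷ σ) (Fin.suc j) (x ∷ u) d =
  trans (cong (meets e x ∧_) (satisfies-at σ j u d)) (sym (∧-assoc (meets e x) _ _))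

sumOver-+ : {A : Set} (xs : List A) (h h′ : A → ℕ) →
  sumOver xs (λ x → h x + h′ x) ≡ sumOver xs h + sumOver xs h′
sumOver-+ []       h h′ = refl
sumOver-+ (x ∷ xs) h h′ =
  trans (cong (h x + h′ x +_) (sumOver-+ xs h h′)) (interchange (h x) (h′ x) _ _)

𝟙-split : ∀ a b → 𝟙 a ≡ 𝟙 (a ∧ b) + 𝟙 (a ∧ not b)
𝟙-split true  true  = refl
𝟙-split true  false = refl
𝟙-split false b     = refl

count-split : ∀ p n (σ : Vec Demand n) j →
  count p n (σ [ j ]≔ free) ≡ count p n (σ [ j ]≔ present) + count p n (σ [ j ]≔ absent)
count-split p n σ j = trans
  (sumOver-cong (allInv n) λ e → trans (𝟙-split (satisfies (σ [ j ]≔ free) (occSet p e)) (lookup (occSet p e) j))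
    (sym (cong₂ _+_ (cong 𝟙 (satisfies-at σ j (occSet p e) present))
                    (cong 𝟙 (satisfies-at σ j (occSet p e) absent)))))
  (sumOver-+ (allInv n) _ _)

-- The number of absent positions, the measure of the Möbius inversion.
absents : ∀ {n} → Vec Demand n → ℕ
absents []            = 0
absents (free ∷ σ)    = absents σ
absents (present ∷ σ) = absents σ
absents (absent ∷ σ)  = suc (absents σ)

some-absent : ∀ {n} (σ : Vec Demand n) k → absents σ ≡ suc k →
  Σ (Fin n) λ j → lookup σ j ≡ absent × absents (σ [ j ]≔ free) ≡ k × absents (σ [ j ]≔ present) ≡ k
some-absent (absent ∷ σ) k e = Fin.zero , refl , suc-injective e , suc-injective e
some-absent (free ∷ σ) k e with some-absent σ k e
... | j , σj , e₁ , e₂ = Fin.suc j , σj , e₁ , e₂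
some-absent (present ∷ σ) k e with some-absent σ k e
... | j , σj , e₁ , e₂ = Fin.suc j , σj , e₁ , e₂

inclusion-exclusion : ∀ p q → (∀ n (σ : Vec Demand n) → absents σ ≡ 0 → count p n σ ≡ count q n σ) →
  ∀ k n (σ : Vec Demand n) → absents σ ≡ k → count p n σ ≡ count q n σ
inclusion-exclusion p q base zero    n σ e = base n σ e
inclusion-exclusion p q base (suc k) n σ e with some-absent σ k e
... | j , σj , e₁ , e₂ = subst (λ s → count p n s ≡ count q n s) restore
  (+-cancelˡ-≡ (count p n (σ [ j ]≔ present)) _ _ (begin
    count p n (σ [ j ]≔ present) + count p n (σ [ j ]≔ absent) ≡⟨ sym (count-split p n σ j) ⟩
    count p n (σ [ j ]≔ free)                                   ≡⟨ IH (σ [ j ]≔ free) e₁ ⟩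
    count q n (σ [ j ]≔ free)                                   ≡⟨ count-split q n σ j ⟩
    count q n (σ [ j ]≔ present) + count q n (σ [ j ]≔ absent) ≡⟨ cong (_+ count q n (σ [ j ]≔ absent))
                                                                     (sym (IH (σ [ j ]≔ present) e₂)) ⟩
    count p n (σ [ j ]≔ present) + count q n (σ [ j ]≔ absent) ∎))
  where
    open ≡-Reasoning
    IH : ∀ (σ′ : Vec Demand n) → absents σ′ ≡ k → count p n σ′ ≡ count q n σ′
    IH = inclusion-exclusion p q base k n
    restore : σ [ j ]≔ absent ≡ σ
    restore = trans (cong (σ [ j ]≔_) (sym σj)) ([]≔-lookup σ j)

-- A specification without absent positions is a set τ of demanded positions.
demanded : ∀ {n} → Vec Demand n → ℕ → Bool
demanded []            _       = false
demanded (present ∷ σ) zero    = true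
demanded (_ ∷ σ)       zero    = false
demanded (_ ∷ σ)       (suc i) = demanded σ i

satisfies-demanded : ∀ {n} (σ : Vec Demand n) → absents σ ≡ 0 → (g : ℕ → Bool) →
  satisfies σ (tabulate (λ i → g (toℕ i))) ≡ ⋀[ i < n ] (demanded σ i ⇒ᵇ g i)
satisfies-demanded []            _ g = refl
satisfies-demanded (free ∷ σ)    e g = cong (true ∧_) (satisfies-demanded σ e (λ i → g (suc i)))
satisfies-demanded (present ∷ σ) e g = cong (g 0 ∧_) (satisfies-demanded σ e (λ i → g (suc i)))

count≡paths : ∀ p m (σ : Vec Demand (suc m)) → absents σ ≡ 0 →
  count p (suc m) σ ≡ when (tailFree (demanded σ) m) (paths p (demanded σ) m (λ _ → 1))
count≡paths p@(R₁ , R₂) m σ e = begin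
  count p (suc m) σ
    ≡⟨ sumOver-cong (allInv (suc m)) (λ x → cong 𝟙 (trans (satisfies-demanded σ e (occAt p (toList x)))
         (demandsMet≡respects R₁ R₂ τ (toList x) m (length-toList x)))) ⟩
  sumOver (allInv (suc m)) (λ x → 𝟙 (respects p τ (toList x) m ∧ tailFree τ m))
    ≡⟨ sumOver-cong (allInv (suc m)) (λ x → 𝟙-∧ (respects p τ (toList x) m) (tailFree τ m)) ⟩
  sumOver (allInv (suc m)) (λ x → when (tailFree τ m) (𝟙 (respects p τ (toList x) m)))
    ≡⟨ sumOver-when (allInv (suc m)) (tailFree τ m) _ ⟩
  when (tailFree τ m) (weighted p τ m (λ _ → 1))
    ≡⟨ cong (when (tailFree τ m)) (weighted≡paths p τ m (λ _ → 1)) ⟩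
  when (tailFree τ m) (paths p τ m (λ _ → 1)) ∎
  where
    open ≡-Reasoning
    τ = demanded σ
    𝟙-∧ : ∀ a b → 𝟙 (a ∧ b) ≡ when b (𝟙 a)
    𝟙-∧ a true  = cong 𝟙 (∧-identityʳ a)
    𝟙-∧ a false = cong 𝟙 (∧-zeroʳ a)

superStrong-by-paths : ∀ p q →
  (∀ τ m → tailFree τ m ≡ true → paths p τ m (λ _ → 1) ≡ paths q τ m (λ _ → 1)) → SuperStrong p q
superStrong-by-paths p q same n S = begin
  numExact p n S            ≡⟨ numExact≡count p n S ⟩
  count p n (exactly S)     ≡⟨ inclusion-exclusion p q base _ n (exactly S) refl ⟩
  count q n (exactly S)     ≡⟨ sym (numExact≡count q n S) ⟩
  numExact q n S            ∎
  where
    open ≡-Reasoning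
    base : ∀ n (σ : Vec Demand n) → absents σ ≡ 0 → count p n σ ≡ count q n σ
    base zero    []  _ = refl
    base (suc m) σ   e = trans (count≡paths p m σ e) (trans
      (cong-when (tailFree (demanded σ) m) (same (demanded σ) m))
      (sym (count≡paths q m σ e)))
      where
        cong-when : ∀ b {x y} → (b ≡ true → x ≡ y) → when b x ≡ when b y
        cong-when true  eq = eq refl
        cong-when false _  = refl

-- The entry in position m
-- lies in [0, m]; if complementing v ↦ m ∸ v turns every constraint of q
-- into the corresponding constraint of p, the path counts agree.
Swaps : Rel → Rel → Set
Swaps R Q = ∀ m v k → v ≤ m → ⟦ Q ⟧ (m ∸ v) (suc m ∸ k) ≡ ⟦ R ⟧ v k

complement-criterion : ∀ R₁ R₂ Q₁ Q₂ → Swaps R₁ Q₁ → Swaps R₂ Q₂ →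
  ∀ τ m → paths (R₁ , R₂) τ m (λ _ → 1) ≡ paths (Q₁ , Q₂) τ m (λ _ → 1)
complement-criterion R₁ R₂ Q₁ Q₂ s₁ s₂ τ m = sym (complemented m (λ _ → 1))
  where
    p q : Pattern
    p = R₁ , R₂
    q = Q₁ , Q₂

    complemented : ∀ m g → paths q τ m g ≡ paths p τ m (λ v → g (m ∸ v))
    complemented zero    g = refl
    complemented (suc m) g = trans (complemented m (extend q τ m g)) (paths-cong p τ m reflected)
      where
        reflected : (λ v → extend q τ m g (m ∸ v)) ≈[ suc m ] extend p τ m (λ k → g (suc m ∸ k))
        reflected v v≤m = trans
          (∑-reverse (suc m) (λ k → when (allowed q (τ m) (previous τ m) (m ∸ v) k) (g k)))
          (∑-cong (2 + m) (λ k _ → cong (λ c → when c (g (suc m ∸ k)))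
            (cong₂ (λ x y → ((τ m) ⇒ᵇ x) ∧ ((previous τ m) ⇒ᵇ y))
                   (s₁ m v k (≤-pred v≤m)) (s₂ m v k (≤-pred v≤m)))))

complement-GE : ∀ {m v k} → v ≤ m → k ≤ v → m ∸ v < suc m ∸ k
complement-GE {m} {v} {k} v≤m k≤v =
  subst (m ∸ v <_) (sym (+-∸-assoc 1 (≤-trans k≤v v≤m))) (s≤s (∸-monoʳ-≤ m k≤v))

complement-LT : ∀ {m v k} → v < k → suc m ∸ k ≤ m ∸ v
complement-LT {m} v<k = ∸-monoʳ-≤ (suc m) v<k

swaps-GE-LT : Swaps GE LT
swaps-GE-LT m v k v≤m = reflects-iff (<ᵇ-reflects-< (m ∸ v) (suc m ∸ k)) (≤ᵇ-reflects-≤ k v)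
  (λ lt → ≮⇒≥ (λ v<k → <⇒≱ lt (complement-LT v<k)))
  (complement-GE v≤m)

swaps-LT-GE : Swaps LT GE
swaps-LT-GE m v k v≤m = reflects-iff (≤ᵇ-reflects-≤ (suc m ∸ k) (m ∸ v)) (<ᵇ-reflects-< v k)
  (λ le → ≰⇒> (λ k≤v → <⇒≱ (complement-GE v≤m k≤v) le))
  complement-LT

-- The three comparisons  k ≤ v,  k < v,  v = k  (that is ⟦ GE ⟧ v k,
-- ⟦ GT ⟧ v k, ⟦ EQ ⟧ v k) take one of only three joint values.
data Profile : Bool → Bool → Bool → Set where
  under : Profile true true false
  level : Profile true false true
  over : Profile false false false

profile : ∀ k v → Profile (k ≤ᵇ v) (k <ᵇ v) (v ≡ᵇ k)
profile k v with <-cmp k v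
... | tri< k<v _ _
  rewrite reflects-true (≤ᵇ-reflects-≤ k v) (<⇒≤ k<v)
        | reflects-true (<ᵇ-reflects-< k v) k<v
        | reflects-false (≡ᵇ-reflects-≡ v k) (≢-sym (<⇒≢ k<v)) = under
... | tri≈ _ refl _
  rewrite reflects-true (≤ᵇ-reflects-≤ k k) ≤-refl
        | reflects-false (<ᵇ-reflects-< k k) (n≮n k)
        | reflects-true (≡ᵇ-reflects-≡ k k) refl = level
... | tri> _ _ v<k
  rewrite reflects-false (≤ᵇ-reflects-≤ k v) (<⇒≱ v<k)
        | reflects-false (<ᵇ-reflects-< k v) (<⇒≯ v<k)
        | reflects-false (≡ᵇ-reflects-≡ v k) (<⇒≢ v<k) = over

GE-and-EQ : ∀ v k → ⟦ GE ⟧ v k ∧ ⟦ EQ ⟧ v k ≡ ⟦ EQ ⟧ v k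
GE-and-EQ v k = go (profile k v)
  where
    go : ∀ {x y z} → Profile x y z → x ∧ z ≡ z
    go under = refl
    go level = refl
    go over = refl

GE-and-GT : ∀ v k → ⟦ GE ⟧ v k ∧ ⟦ GT ⟧ v k ≡ ⟦ GT ⟧ v k
GE-and-GT v k = go (profile k v)
  where
    go : ∀ {x y z} → Profile x y z → x ∧ y ≡ y
    go under = refl
    go level = refl
    go over = refl

GT-and-EQ : ∀ v k → ⟦ GT ⟧ v k ∧ ⟦ EQ ⟧ v k ≡ false
GT-and-EQ v k = go (profile k v)
  where
    go : ∀ {x y z} → Profile x y z → y ∧ z ≡ false
    go under = refl
    go level = refl
    go over = refl

Local : ((ℕ → ℕ) → ℕ → ℕ) → Set
Local A = ∀ N {f g} → f ≈[ N ] g → A f ≈[ N ] A g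

-- The demanded occurrences form
-- maximal runs of consecutive positions.  Suppose that, on the relevant
-- range, p transfers through a run as A D … D (close through R₂ of p) and
-- q as C D … D (close through R₂ of q), where D commutes with A and C and
-- closing through p after A equals closing through q after C.  Then the
-- two patterns have the same path counts whenever no run is open.
module RunCriterion (p q : Pattern) (A C D : (ℕ → ℕ) → ℕ → ℕ)
  (A-local : Local A) (C-local : Local C) (D-local : Local D)
  (A-D : ∀ g v → A (D g) v ≡ D (A g) v)
  (C-D : ∀ g v → C (D g) v ≡ D (C g) v)
  (open-p : ∀ m g → extendWith p true false m g ≈[ suc m ] A g)
  (open-q : ∀ m g → extendWith q true false m g ≈[ suc m ] C g)
  (inner-p : ∀ m g → extendWith p true true m g ≈[ suc m ] D g)
  (inner-q : ∀ m g → extendWith q true true m g ≈[ suc m ] D g)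
  (close : ∀ m g → A (extendWith p false true m g) ≈[ suc m ] C (extendWith q false true m g))
  (τ : ℕ → Bool)
  where

  open ≡-Reasoning

  Stable : ℕ → ((ℕ → ℕ) → ℕ) → Set
  Stable m Y = ∀ f g → f ≈[ suc m ] g → Y f ≡ Y g

  Closed : ℕ → Set
  Closed m = ∀ g → paths p τ m g ≡ paths q τ m g

  -- A run is open at m: the two path counts differ only by the opening
  -- operators A and C still to be applied.
  Open : ℕ → Set
  Open m = Σ ((ℕ → ℕ) → ℕ) λ Y → Stable m Y
    × (∀ g → paths p τ m g ≡ Y (A g)) × (∀ g → paths q τ m g ≡ Y (C g))

  Invariant : ℕ → Bool → Set
  Invariant m false = Closed m
  Invariant m true  = Open m

  step : ∀ m b c → previous τ m ≡ b → τ m ≡ c → Invariant m b → Invariant (suc m) c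
  step m false false e₁ e₂ closed g = trans (closed (extend p τ m g)) (paths-cong q τ m λ v _ →
    trans (extend-at p τ m g v e₂ e₁) (sym (extend-at q τ m g v e₂ e₁)))
  step m false true e₁ e₂ closed = paths q τ m , stable , via-p , via-q
    where
      stable : Stable (suc m) (paths q τ m)
      stable f g f≈g = paths-cong q τ m (λ v v< → f≈g v (m≤n⇒m≤1+n v<))
      via-p : ∀ g → paths p τ (suc m) g ≡ paths q τ m (A g)
      via-p g = trans (closed (extend p τ m g)) (paths-cong q τ m λ v v< →
        trans (extend-at p τ m g v e₂ e₁) (open-p m g v v<))
      via-q : ∀ g → paths q τ (suc m) g ≡ paths q τ m (C g)
      via-q g = paths-cong q τ m λ v v< → trans (extend-at q τ m g v e₂ e₁) (open-q m g v v<)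
  step m true true e₁ e₂ (Y , stable , via-p , via-q) = Y ∘ D , stable′ , via-p′ , via-q′
    where
      stable′ : Stable (suc m) (Y ∘ D)
      stable′ f g f≈g = stable (D f) (D g) (D-local (suc m) (λ v v< → f≈g v (m≤n⇒m≤1+n v<)))
      via-p′ : ∀ g → paths p τ (suc m) g ≡ Y (D (A g))
      via-p′ g = begin
        paths p τ m (extend p τ m g)    ≡⟨ via-p (extend p τ m g) ⟩
        Y (A (extend p τ m g))          ≡⟨ stable _ _ (A-local (suc m) λ v v< →
                                             trans (extend-at p τ m g v e₂ e₁) (inner-p m g v v<)) ⟩
        Y (A (D g))                     ≡⟨ stable _ _ (λ v _ → A-D g v) ⟩
        Y (D (A g))                     ∎
      via-q′ : ∀ g → paths q τ (suc m) g ≡ Y (D (C g))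
      via-q′ g = begin
        paths q τ m (extend q τ m g)    ≡⟨ via-q (extend q τ m g) ⟩
        Y (C (extend q τ m g))          ≡⟨ stable _ _ (C-local (suc m) λ v v< →
                                             trans (extend-at q τ m g v e₂ e₁) (inner-q m g v v<)) ⟩
        Y (C (D g))                     ≡⟨ stable _ _ (λ v _ → C-D g v) ⟩
        Y (D (C g))                     ∎
  step m true false e₁ e₂ (Y , stable , via-p , via-q) g = begin
    paths p τ m (extend p τ m g)                ≡⟨ via-p (extend p τ m g) ⟩
    Y (A (extend p τ m g))                      ≡⟨ stable _ _ (A-local (suc m) λ v _ → extend-at p τ m g v e₂ e₁) ⟩
    Y (A (extendWith p false true m g))         ≡⟨ stable _ _ (close m g) ⟩
    Y (C (extendWith q false true m g))         ≡⟨ stable _ _ (C-local (suc m) λ v _ → sym (extend-at q τ m g v e₂ e₁)) ⟩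
    Y (C (extend q τ m g))                      ≡⟨ sym (via-q (extend q τ m g)) ⟩
    paths q τ m (extend q τ m g)                ∎

  invariant : ∀ m → Invariant m (previous τ m)
  invariant zero    g = refl
  invariant (suc m) = step m (previous τ m) (τ m) refl refl (invariant m)

  runs-criterion : ∀ m → previous τ m ≡ false → ∀ g → paths p τ m g ≡ paths q τ m g
  runs-criterion m e = subst (Invariant m) e (invariant m)

through : Rel → ℕ → (ℕ → ℕ) → ℕ → ℕ
through R m g v = ∑[ k < 2 + m ] when (⟦ R ⟧ v k) (g k)

opening : ∀ R₁ R₂ m g v → extendWith (R₁ , R₂) true false m g v ≡ through R₁ m g v
opening R₁ R₂ m g v = ∑-cong (2 + m) (λ k _ → cong (λ c → when c (g k)) (∧-identityʳ (⟦ R₁ ⟧ v k)))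

inside : ∀ R₁ R₂ R → (∀ v k → ⟦ R₁ ⟧ v k ∧ ⟦ R₂ ⟧ v k ≡ ⟦ R ⟧ v k) →
  ∀ m g v → extendWith (R₁ , R₂) true true m g v ≡ through R m g v
inside R₁ R₂ R meet m g v = ∑-cong (2 + m) (λ k _ → cong (λ c → when c (g k)) (meet v k))

inside-empty : ∀ R₁ R₂ → (∀ v k → ⟦ R₁ ⟧ v k ∧ ⟦ R₂ ⟧ v k ≡ false) →
  ∀ m g v → extendWith (R₁ , R₂) true true m g v ≡ 0
inside-empty R₁ R₂ disjoint m g v =
  trans (∑-cong (2 + m) (λ k _ → cong (λ c → when c (g k)) (disjoint v k))) (∑-zero (2 + m))

atMost : (ℕ → ℕ) → ℕ → ℕ
atMost g v = ∑< (suc v) g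

below : (ℕ → ℕ) → ℕ → ℕ
below g v = ∑< v g

through-GE : ∀ m g → through GE m g ≈[ suc m ] atMost g
through-GE m g v v≤m = ∑-upTo (2 + m) v g (m≤n⇒m≤1+n v≤m)

through-GT : ∀ m g → through GT m g ≈[ suc m ] below g
through-GT m g v v≤m = ∑-below (2 + m) v g (m≤n⇒m≤1+n (m≤n⇒m≤1+n (≤-pred v≤m)))

through-EQ : ∀ m g → through EQ m g ≈[ suc m ] g
through-EQ m g v v≤m = ∑-at (2 + m) v g (m≤n⇒m≤1+n v≤m)

atMost-local : Local atMost
atMost-local N f≈g v v<N = ∑-cong (suc v) (λ k k≤v → f≈g k (≤-<-trans (≤-pred k≤v) v<N))

below-local : Local below
below-local N f≈g v v<N = ∑-cong v (λ k k<v → f≈g k (<-trans k<v v<N))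

id-local : Local id
id-local N f≈g = f≈g

zero-local : Local (λ _ _ → 0)
zero-local N f≈g v _ = refl

paths-iii : ∀ τ m → previous τ m ≡ false → ∀ g → paths (GE , EQ) τ m g ≡ paths (EQ , GE) τ m g
paths-iii τ = runs-criterion
  where
    EQ-and-GE : ∀ v k → ⟦ EQ ⟧ v k ∧ ⟦ GE ⟧ v k ≡ ⟦ EQ ⟧ v k
    EQ-and-GE v k = trans (∧-comm (⟦ EQ ⟧ v k) _) (GE-and-EQ v k)
    open RunCriterion (GE , EQ) (EQ , GE) atMost id id atMost-local id-local id-local
      (λ _ _ → refl) (λ _ _ → refl)
      (λ m g v v≤m → trans (opening GE EQ m g v) (through-GE m g v v≤m))
      (λ m g v v≤m → trans (opening EQ GE m g v) (through-EQ m g v v≤m))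
      (λ m g v v≤m → trans (inside GE EQ EQ GE-and-EQ m g v) (through-EQ m g v v≤m))
      (λ m g v v≤m → trans (inside EQ GE EQ EQ-and-GE m g v) (through-EQ m g v v≤m))
      (λ m g v v≤m → trans (∑-cong (suc v) λ j j≤v → through-EQ m g j (≤-<-trans (≤-pred j≤v) v≤m))
                           (sym (through-GE m g v v≤m)))
      τ

paths-iv : ∀ τ m → previous τ m ≡ false → ∀ g → paths (GE , GT) τ m g ≡ paths (GT , GE) τ m g
paths-iv τ = runs-criterion
  where
    GT-and-GE : ∀ v k → ⟦ GT ⟧ v k ∧ ⟦ GE ⟧ v k ≡ ⟦ GT ⟧ v k
    GT-and-GE v k = trans (∧-comm (⟦ GT ⟧ v k) _) (GE-and-GT v k)
    open RunCriterion (GE , GT) (GT , GE) atMost below below atMost-local below-local below-local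
      (λ _ _ → refl) (λ _ _ → refl)
      (λ m g v v≤m → trans (opening GE GT m g v) (through-GE m g v v≤m))
      (λ m g v v≤m → trans (opening GT GE m g v) (through-GT m g v v≤m))
      (λ m g v v≤m → trans (inside GE GT GT GE-and-GT m g v) (through-GT m g v v≤m))
      (λ m g v v≤m → trans (inside GT GE GT GT-and-GE m g v) (through-GT m g v v≤m))
      (λ m g v v≤m → trans (∑-cong (suc v) λ j j≤v → through-GT m g j (≤-<-trans (≤-pred j≤v) v≤m))
                           (sym (∑-cong v λ j j<v → through-GE m g j (<-trans j<v v≤m))))
      τ

paths-v : ∀ τ m → previous τ m ≡ false → ∀ g → paths (GT , EQ) τ m g ≡ paths (EQ , GT) τ m g
paths-v τ = runs-criterion
  where
    EQ-and-GT : ∀ v k → ⟦ EQ ⟧ v k ∧ ⟦ GT ⟧ v k ≡ false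
    EQ-and-GT v k = trans (∧-comm (⟦ EQ ⟧ v k) _) (GT-and-EQ v k)
    open RunCriterion (GT , EQ) (EQ , GT) below id (λ _ _ → 0) below-local id-local zero-local
      (λ _ v → ∑-zero v) (λ _ _ → refl)
      (λ m g v v≤m → trans (opening GT EQ m g v) (through-GT m g v v≤m))
      (λ m g v v≤m → trans (opening EQ GT m g v) (through-EQ m g v v≤m))
      (λ m g v _ → inside-empty GT EQ GT-and-EQ m g v)
      (λ m g v _ → inside-empty EQ GT EQ-and-GT m g v)
      (λ m g v v≤m → trans (∑-cong v λ j j<v → through-EQ m g j (<-trans j<v v≤m))
                           (sym (through-GT m g v v≤m)))
      τ

superStrong-i : SuperStrong (GE , LT) (LT , GE)
superStrong-i = superStrong-by-paths (GE , LT) (LT , GE)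
  (λ τ m _ → complement-criterion GE LT LT GE swaps-GE-LT swaps-LT-GE τ m)

superStrong-ii : SuperStrong (GE , GE) (LT , LT)
superStrong-ii = superStrong-by-paths (GE , GE) (LT , LT)
  (λ τ m _ → complement-criterion GE GE LT LT swaps-GE-LT swaps-GE-LT τ m)

superStrong-iii : SuperStrong (GE , EQ) (EQ , GE)
superStrong-iii = superStrong-by-paths (GE , EQ) (EQ , GE)
  (λ τ m e → paths-iii τ m (tailFree⇒¬previous τ m e) (λ _ → 1))

superStrong-iv : SuperStrong (GE , GT) (GT , GE)
superStrong-iv = superStrong-by-paths (GE , GT) (GT , GE)
  (λ τ m e → paths-iv τ m (tailFree⇒¬previous τ m e) (λ _ → 1))

superStrong-v : SuperStrong (GT , EQ) (EQ , GT)
superStrong-v = superStrong-by-paths (GT , EQ) (EQ , GT)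
  (λ τ m e → paths-v τ m (tailFree⇒¬previous τ m e) (λ _ → 1))

avoids : Pattern → List ℕ → Bool
avoids p w = ⋀[ i < length w ] not (occAt p w i)

avoids-cons : ∀ p a r → avoids p (a ∷ r) ≡ not (occAt p (a ∷ r) 0) ∧ avoids p r
avoids-cons p a r = cong (not (occAt p (a ∷ r) 0) ∧_) (⋀-cong (length r) (λ i _ → cong not (occAt-suc p a r i)))

numAvoid≡ : ∀ p n → numAvoid p n ≡ sumOver (allInv n) (λ e → 𝟙 (avoids p (toList e)))
numAvoid≡ p n = trans (numExact≡count p n Subset.⊥) (sumOver-cong (allInv n) λ e →
  cong 𝟙 (trans (satisfies-nothing n (occAt p (toList e)))
                (cong (λ l → ⋀[ i < l ] not (occAt p (toList e) i)) (sym (length-toList e)))))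
  where
    satisfies-nothing : ∀ n g → satisfies (exactly (Subset.⊥ {n})) (tabulate (λ i → g (toℕ i))) ≡ ⋀[ i < n ] not (g i)
    satisfies-nothing zero    g = refl
    satisfies-nothing (suc n) g = cong (not (g 0) ∧_) (satisfies-nothing n (λ i → g (suc i)))

-- In a word whose first pair ascends or is 0 0, an occurrence of (≠,≥)
-- forces one of (<,≥): the word ascends strictly after its leading zeros.
Start : ℕ → ℕ → Set
Start a b = a < b ⊎ (a ≡ 0 × b ≡ 0)

start-0 : ∀ b → Start 0 b
start-0 zero    = inj₂ (refl , refl)
start-0 (suc b) = inj₁ (s≤s z≤n)

avoids-LT-GE⇔NE-GE : ∀ a b r → Start a b → avoids (LT , GE) (a ∷ b ∷ r) ≡ avoids (NE , GE) (a ∷ b ∷ r)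
avoids-LT-GE⇔NE-GE a b []      _ = refl
avoids-LT-GE⇔NE-GE a b (c ∷ r) (inj₂ (refl , refl)) =
  trans (avoids-cons (LT , GE) 0 (0 ∷ c ∷ r))
    (trans (avoids-LT-GE⇔NE-GE 0 c r (start-0 c)) (sym (avoids-cons (NE , GE) 0 (0 ∷ c ∷ r))))
avoids-LT-GE⇔NE-GE a b (c ∷ r) (inj₁ a<b) with c ≤? b
... | yes c≤b = trans (avoids-cons (LT , GE) a (b ∷ c ∷ r))
  (trans (cong₂ (λ x y → not (x ∧ y) ∧ avoids (LT , GE) (b ∷ c ∷ r))
            (reflects-true (<ᵇ-reflects-< a b) a<b) (reflects-true (≤ᵇ-reflects-≤ c b) c≤b))
    (sym (trans (avoids-cons (NE , GE) a (b ∷ c ∷ r))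
      (cong₂ (λ x y → not (not x ∧ y) ∧ avoids (NE , GE) (b ∷ c ∷ r))
            (reflects-false (≡ᵇ-reflects-≡ a b) (<⇒≢ a<b)) (reflects-true (≤ᵇ-reflects-≤ c b) c≤b)))))
... | no c≰b = trans (avoids-cons (LT , GE) a (b ∷ c ∷ r))
  (trans (cong₂ _∧_ leading (avoids-LT-GE⇔NE-GE b c r (inj₁ (≰⇒> c≰b))))
    (sym (avoids-cons (NE , GE) a (b ∷ c ∷ r))))
  where
    leading : not ((a <ᵇ b) ∧ (c ≤ᵇ b)) ≡ not (not (a ≡ᵇ b) ∧ (c ≤ᵇ b))
    leading = cong (λ x → not (x ∧ (c ≤ᵇ b)))
      (trans (reflects-true (<ᵇ-reflects-< a b) a<b) (sym (cong not (reflects-false (≡ᵇ-reflects-≡ a b) (<⇒≢ a<b)))))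

StartsAtZero : List ℕ → Set
StartsAtZero []      = ⊤
StartsAtZero (x ∷ _) = x ≡ 0

allInv-startsAtZero : ∀ n → All (λ e → StartsAtZero (toList e)) (allInv n)
allInv-startsAtZero zero    = tt ∷ []
allInv-startsAtZero (suc n) = concat⁺ (map⁺ (All.map appended (allInv-startsAtZero n)))
  where
    appended : ∀ {e : Vec ℕ n} → StartsAtZero (toList e) →
               All (λ e′ → StartsAtZero (toList e′)) (map (e ∷ʳ_) (applyUpTo id (suc n)))
    appended {[]}    _   = map⁺ {f = [] ∷ʳ_} (applyUpTo⁺₁ id 1 λ { (s≤s z≤n) → refl })
    appended {x ∷ e} x≡0 = map⁺ {f = (x ∷ e) ∷ʳ_} (applyUpTo⁺₂ id (suc n) λ _ → x≡0)

wilf-i : Wilf (LT , GE) (NE , GE)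
wilf-i n = trans (numAvoid≡ (LT , GE) n) (trans
  (cong sum (map-cong-local (All.map (λ {e} → same e) (allInv-startsAtZero n))))
  (sym (numAvoid≡ (NE , GE) n)))
  where
    same : ∀ {m} (e : Vec ℕ m) → StartsAtZero (toList e) → 𝟙 (avoids (LT , GE) (toList e)) ≡ 𝟙 (avoids (NE , GE) (toList e))
    same []              _   = refl
    same (x ∷ [])        _   = refl
    same (x ∷ y ∷ e) refl = cong 𝟙 (avoids-LT-GE⇔NE-GE 0 y (toList e) (start-0 y))

Related : Pattern → Pattern → Set
Related p q = p ≡ q ⊎ SameGroup p q

group-unique : ∀ {g h p} → InGroup g p → InGroup h p → g ≡ h
group-unique g1a g1a = refl
group-unique g1b g1b = refl
group-unique g1c g1c = refl
group-unique g2a g2a = refl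
group-unique g2b g2b = refl
group-unique g3a g3a = refl
group-unique g3b g3b = refl
group-unique g4a g4a = refl
group-unique g4b g4b = refl
group-unique g5a g5a = refl
group-unique g5b g5b = refl

related-sym : ∀ {p q} → Related p q → Related q p
related-sym (inj₁ refl)          = inj₁ refl
related-sym (inj₂ (g , gp , gq)) = inj₂ (g , gq , gp)

related-trans : ∀ {p q r} → Related p q → Related q r → Related p r
related-trans (inj₁ refl) qr = qr
related-trans pq (inj₁ refl) = pq
related-trans (inj₂ (g , gp , gq)) (inj₂ (h , hq , hr)) with group-unique gq hq
... | refl = inj₂ (g , gp , hr)

-- The number of avoiders of length 6 determines a pattern up to its
-- group: a representative for each of the 30 values taken.
table : List (ℕ × Pattern)
table =
    (36 , LE , LE)
  ∷ (6 , LE , GE)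
  ∷ (70 , LE , LT)
  ∷ (132 , LE , GT)
  ∷ (304 , LE , EQ)
  ∷ (2 , LE , NE)
  ∷ (13 , GE , LE)
  ∷ (349 , GE , GE)
  ∷ (32 , GE , LT)
  ∷ (584 , GE , GT)
  ∷ (448 , GE , EQ)
  ∷ (16 , GE , NE)
  ∷ (157 , LT , LE)
  ∷ (216 , LT , GT)
  ∷ (407 , LT , EQ)
  ∷ (100 , LT , NE)
  ∷ (272 , GT , LE)
  ∷ (368 , GT , LT)
  ∷ (684 , GT , GT)
  ∷ (618 , GT , EQ)
  ∷ (346 , GT , NE)
  ∷ (190 , EQ , LE)
  ∷ (210 , EQ , LT)
  ∷ (531 , EQ , EQ)
  ∷ (154 , EQ , NE)
  ∷ (20 , NE , LE)
  ∷ (170 , NE , LT)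
  ∷ (214 , NE , GT)
  ∷ (326 , NE , EQ)
  ∷ (76 , NE , NE)
  ∷ []

representative : ℕ → Pattern
representative n = pick table
  where
    pick : List (ℕ × Pattern) → Pattern
    pick []               = LE , LE
    pick ((k , p) ∷ rest) = if n ≡ᵇ k then p else pick rest

-- Verified by computing |I₆(p)| for all 36 patterns.
determined : ∀ p → Related p (representative (numAvoid p 6))
determined (LE , LE) = inj₁ refl
determined (LE , GE) = inj₁ refl
determined (LE , LT) = inj₁ refl
determined (LE , GT) = inj₁ refl
determined (LE , EQ) = inj₁ refl
determined (LE , NE) = inj₁ refl
determined (GE , LE) = inj₁ refl
determined (GE , GE) = inj₁ refl
determined (GE , LT) = inj₁ refl
determined (GE , GT) = inj₁ refl
determined (GE , EQ) = inj₁ refl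
determined (GE , NE) = inj₁ refl
determined (LT , LE) = inj₁ refl
determined (LT , GE) = inj₂ (Fin.zero , g1b , g1a)
determined (LT , LT) = inj₂ (Fin.suc Fin.zero , g2b , g2a)
determined (LT , GT) = inj₁ refl
determined (LT , EQ) = inj₁ refl
determined (LT , NE) = inj₁ refl
determined (GT , LE) = inj₁ refl
determined (GT , GE) = inj₂ (Fin.suc (Fin.suc (Fin.suc Fin.zero)) , g4b , g4a)
determined (GT , LT) = inj₁ refl
determined (GT , GT) = inj₁ refl
determined (GT , EQ) = inj₁ refl
determined (GT , NE) = inj₁ refl
determined (EQ , LE) = inj₁ refl
determined (EQ , GE) = inj₂ (Fin.suc (Fin.suc Fin.zero) , g3b , g3a)
determined (EQ , LT) = inj₁ refl
determined (EQ , GT) = inj₂ (Fin.suc (Fin.suc (Fin.suc (Fin.suc Fin.zero))) , g5b , g5a)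
determined (EQ , EQ) = inj₁ refl
determined (EQ , NE) = inj₁ refl
determined (NE , LE) = inj₁ refl
determined (NE , GE) = inj₂ (Fin.zero , g1c , g1a)
determined (NE , LT) = inj₁ refl
determined (NE , GT) = inj₁ refl
determined (NE , EQ) = inj₁ refl
determined (NE , NE) = inj₁ refl

not-wilf : (p q : Pattern) → p ≢ q → ¬ SameGroup p q → ¬ Wilf p q
not-wilf p q p≢q ¬same wilf with related-trans (determined p)
  (related-sym (subst (Related q ∘ representative) (sym (wilf 6)) (determined q)))
... | inj₁ p≡q  = p≢q p≡q
... | inj₂ same = ¬same same

theorem2p1 : (SuperStrong (GE , LT) (LT , GE) × Wilf (LT , GE) (NE , GE))
    × SuperStrong (GE , GE) (LT , LT)
    × SuperStrong (GE , EQ) (EQ , GE)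
    × SuperStrong (GE , GT) (GT , GE)
    × SuperStrong (GT , EQ) (EQ , GT)
    × ((p q : Pattern) → p ≢ q → ¬ SameGroup p q → ¬ Wilf p q)
theorem2p1 = (superStrong-i , wilf-i) , superStrong-ii , superStrong-iii , superStrong-iv , superStrong-v , not-wilf
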